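{- Suppose $A$ is a set and $(B,\geq)$ is a well-order representing the equivalence class $\textsf{card}[A]\in\mathbb{W}$. Then there is a bijection $A\simeq B$.
   Context: Framework: object generators (primitive collections), morphisms between them, a two-element generator $\{\textsf{yes},\textsf{no}\}$, binary functions (morphisms to it); excluded middle is not assumed in general. A logical domain is a generator with a binary equality pairing; a (relaxed) set is a domain with a binary function on its powerset detecting the constantly-$\textsf{no}$ function. Axioms of Choice, Infinity, Quantification are assumed. $\mathbb{W}$ is the domain of order-isomorphism classes of well-orders (linear orders on sets in which every downward-closed binary subdomain is everything or an initial segment), ordered by "order-isomorphic to an initial segment of"; $(\#<a)=\{x\in\mathbb{W}: x<a\}$. For a set $A$, choose a well-order on it; $\textsf{card}[A]$ is the least $c\in\mathbb{W}$ such that there is an injection from $A$ into $(\#<c)$ (equivalently, from the class of the chosen well-order of $A$ to $c$); this does not depend on the choice. -}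

module Defs where

open import Level using (Level; 0ℓ) renaming (suc to lsuc)
open import Data.Bool using (Bool; true; false; _∧_)
open import Data.Product using (Σ; Σ-syntax; ∃; ∃-syntax; _×_; _,_; proj₁)
open import Data.Sum using (_⊎_)
open import Relation.Binary.PropositionalEquality using (_≡_)
open import Function.Bundles using (_↔_; _⇔_; Inverse)

-- The two-element generator {yes, no}: yes = true, no = false.
-- A binary function on X is a map X → Bool.

record Domain : Set₁ where
  field
    Carrier : Set
    eqB     : Carrier → Carrier → Bool
    eqB-spec : ∀ x y → (eqB x y ≡ true) ⇔ (x ≡ y)

-- A (relaxed) set: a domain with a binary function on its powerset
-- (binary functions Carrier → Bool) detecting the constantly-no function.
record SetD : Set₁ where
  field
    domain : Domain
  open Domain domain public
  field
    isEmpty      : (Carrier → Bool) → Bool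
    isEmpty-spec : ∀ (P : Carrier → Bool) →
                   (isEmpty P ≡ true) ⇔ (∀ x → P x ≡ false)

record IsWellOrder (A : SetD) (le : SetD.Carrier A → SetD.Carrier A → Bool) : Set where
  open SetD A
  _≤_ : Carrier → Carrier → Set
  x ≤ y = le x y ≡ true
  _<_ : Carrier → Carrier → Set
  x < y = (le x y ≡ true) × (eqB x y ≡ false)
  field
    refl    : ∀ x → x ≤ x
    antisym : ∀ x y → x ≤ y → y ≤ x → x ≡ y
    trans   : ∀ x y z → x ≤ y → y ≤ z → x ≤ z
    total   : ∀ x y → (x ≤ y) ⊎ (y ≤ x)
    wellOrd : ∀ (P : Carrier → Bool) →
              (∀ x y → x ≤ y → P y ≡ true → P x ≡ true) →
              (∀ x → P x ≡ true) ⊎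
              (Σ[ a ∈ Carrier ] (∀ x → (P x ≡ true) ⇔ (x < a)))

-- A well-ordered set (a representative of an element of 𝕎).
record WellOrder : Set₁ where
  field
    set  : SetD
  open SetD set public
  field
    le   : Carrier → Carrier → Bool
    isWO : IsWellOrder set le
  open IsWellOrder isWO public using (_≤_; _<_)

open WellOrder

-- Order-isomorphism of well-orders (equality of classes in 𝕎).
_≅_ : WellOrder → WellOrder → Set
X ≅ Y = Σ[ f ∈ (Carrier X ↔ Carrier Y) ]
          (∀ x x' → _≤_ X x x' ⇔ _≤_ Y (Inverse.to f x) (Inverse.to f x'))

_<𝕎_ : WellOrder → WellOrder → Set
X <𝕎 Y = Σ[ a₀ ∈ Carrier Y ] Σ[ f ∈ (Carrier X → Carrier Y) ]
           ((∀ x x' → _≤_ X x x' ⇔ _≤_ Y (f x) (f x')) ×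
            (∀ x x' → f x ≡ f x' → x ≡ x') ×
            (∀ y → _<_ Y y a₀ ⇔ (Σ[ x ∈ Carrier X ] f x ≡ y)))

_≤𝕎_ : WellOrder → WellOrder → Set
X ≤𝕎 Y = (X <𝕎 Y) ⊎ (X ≅ Y)

-- (#< c) = { x ∈ 𝕎 | x < c }, elements compared up to order-isomorphism.
#<_ : WellOrder → Set₁
#< c = Σ[ x ∈ WellOrder ] (x <𝕎 c)

InjInto#< : SetD → WellOrder → Set₁
InjInto#< A c = Σ[ f ∈ (SetD.Carrier A → #< c) ]
                  (∀ a a' → proj₁ (f a) ≅ proj₁ (f a') → a ≡ a')

IsCard : SetD → WellOrder → Set₁
IsCard A c = InjInto#< A c × (∀ c' → InjInto#< A c' → c ≤𝕎 c')

-- Let f : A → (#< B) be the injection witnessing card[A] = B. Each f a is an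
-- initial segment of B below some bound g a; two segments with the same bound are
-- isomorphic, so g : A → B is injective, and pulling the order of B back along g
-- gives a well-order C on A that embeds into B. Every well-ordered set injects into
-- the initial segments below itself, so minimality of B gives B <𝕎 C or B ≅ C. The
-- first is impossible: composing B <𝕎 C with C ↪ B maps the element g a₀ of B (a₀
-- the bound in C) strictly below itself, while a monotone injection of a well-order
-- into itself never decreases an element. Hence B ≅ C, a bijection A ↔ B.
module Submission where

open import Defs
open import Axiom.UniquenessOfIdentityProofs using (module Decidable⇒UIP)
open import Data.Bool using (Bool; true; false; _∧_; not)
open import Data.Bool.Properties using (_≟_; not-¬; ¬-not; not-injective)
open import Data.Empty using (⊥; ⊥-elim)
open import Data.Product using (Σ-syntax; _×_; _,_; proj₁; proj₂)
open import Data.Sum using (_⊎_; inj₁; inj₂; [_,_]′)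
open import Function.Base using (_∘_; id)
open import Function.Bundles using (_↔_; _↣_; _⇔_; Inverse; Injection; Equivalence; mk↔ₛ′; mk↣; mk⇔)
open import Function.Definitions using (Injective)
open import Function.Properties.Inverse using (↔-sym; ↔⇒↣)
open import Relation.Nullary using (¬_)
open import Relation.Binary.PropositionalEquality
  using (_≡_; _≢_; refl; sym; trans; cong; subst; subst₂)

open Equivalence using () renaming (to to ⇔-to; from to ⇔-from)

private
  variable
    X Y Z : WellOrder

≢false⇒≡true : ∀ {b} → b ≢ false → b ≡ true
≢false⇒≡true = ¬-not

≢true⇒≡false : ∀ {b} → b ≢ true → b ≡ false
≢true⇒≡false = ¬-not

∧-≡true : ∀ {b c} → b ∧ c ≡ true → b ≡ true × c ≡ true
∧-≡true {true} {true} _ = refl , refl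

≡true-∧ : ∀ {b c} → b ≡ true → c ≡ true → b ∧ c ≡ true
≡true-∧ refl refl = refl

module DomainProperties (D : Domain) where
  open Domain D

  eqB⇒≡ : ∀ {x y} → eqB x y ≡ true → x ≡ y
  eqB⇒≡ = ⇔-to (eqB-spec _ _)

  ≡⇒eqB : ∀ {x y} → x ≡ y → eqB x y ≡ true
  ≡⇒eqB = ⇔-from (eqB-spec _ _)

  eqB≡false⇒≢ : ∀ {x y} → eqB x y ≡ false → x ≢ y
  eqB≡false⇒≢ ne x≡y = not-¬ (≡⇒eqB x≡y) ne

  ≢⇒eqB≡false : ∀ {x y} → x ≢ y → eqB x y ≡ false
  ≢⇒eqB≡false x≢y = ≢true⇒≡false (x≢y ∘ eqB⇒≡)

NonEmpty : {C : Set} → (C → Bool) → Set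
NonEmpty P = ¬ (∀ x → P x ≡ false)

isEmpty≡false⇒NonEmpty : ∀ {Y : SetD} {P} → SetD.isEmpty Y P ≡ false → NonEmpty P
isEmpty≡false⇒NonEmpty {Y} e none = not-¬ (⇔-from (SetD.isEmpty-spec Y _) none) e

-- A set only decides emptiness of a binary subdomain; actual elements come from
-- least elements of a well-order.
Witnessing : SetD → Set
Witnessing Y = (T : SetD.Carrier Y → Bool) → NonEmpty T →
               Σ[ y ∈ SetD.Carrier Y ] T y ≡ true

module _ (Y : SetD) (le : SetD.Carrier Y → SetD.Carrier Y → Bool) where
  open SetD Y

  Least : (Carrier → Bool) → Set
  Least S = Σ[ x₀ ∈ Carrier ] (S x₀ ≡ true × (∀ y → S y ≡ true → le x₀ y ≡ true))

  HasLeast : Set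
  HasLeast = ∀ S → NonEmpty S → Least S

  WellOrdered : Set
  WellOrdered = ∀ (P : Carrier → Bool) →
    (∀ x y → le x y ≡ true → P y ≡ true → P x ≡ true) →
    (∀ x → P x ≡ true) ⊎
    (Σ[ a ∈ Carrier ] (∀ x → (P x ≡ true) ⇔ ((le x a ≡ true) × (eqB x a ≡ false))))

module _ {Y : SetD} {le : SetD.Carrier Y → SetD.Carrier Y → Bool} (W : IsWellOrder Y le) where
  open SetD Y
  open DomainProperties domain
  open IsWellOrder W renaming (refl to ≤-refl; trans to ≤-trans)

  -- The points below which S is empty form an initial segment; its bound is least in S.
  least : HasLeast Y le
  least S S≠∅ = fromSegment (wellOrd noneBelow noneBelow-downClosed)
    where
    noneBelow : Carrier → Bool
    noneBelow x = isEmpty (λ y → S y ∧ le y x)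

    noneBelow-elim : ∀ {x y} → noneBelow x ≡ true → S y ≡ true → le y x ≡ true → ⊥
    noneBelow-elim d s l = not-¬ (≡true-∧ s l) (⇔-to (isEmpty-spec _) d _)

    noneBelow-intro : ∀ {x} → (∀ {y} → S y ≡ true → le y x ≡ true → ⊥) → noneBelow x ≡ true
    noneBelow-intro h = ⇔-from (isEmpty-spec _) λ y →
      ≢true⇒≡false λ e → let (s , l) = ∧-≡true e in h s l

    noneBelow-downClosed : ∀ x y → le x y ≡ true → noneBelow y ≡ true → noneBelow x ≡ true
    noneBelow-downClosed x y x≤y d =
      noneBelow-intro λ s l → noneBelow-elim d s (≤-trans _ x y l x≤y)

    fromSegment : (∀ x → noneBelow x ≡ true) ⊎
                  (Σ[ a ∈ Carrier ] (∀ x → (noneBelow x ≡ true) ⇔ (x < a))) → Least Y le S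
    fromSegment (inj₁ allNone) =
      ⊥-elim (S≠∅ λ x → ≢true⇒≡false λ s → noneBelow-elim (allNone x) s (≤-refl x))
    fromSegment (inj₂ (x₀ , seg)) = x₀ , Sx₀ , minimal
      where
      Sx₀ : S x₀ ≡ true
      Sx₀ = ≢false⇒≡true λ Sx₀≡false →
        let x₀<x₀ = ⇔-to (seg x₀) (noneBelow-intro λ {y} s l →
              noneBelow-elim (⇔-from (seg y) (l , ≢⇒eqB≡false λ { refl → not-¬ s Sx₀≡false }))
                             s (≤-refl y))
        in eqB≡false⇒≢ (proj₂ x₀<x₀) refl

      minimal : ∀ y → S y ≡ true → le x₀ y ≡ true
      minimal y s with total x₀ y
      ... | inj₁ x₀≤y = x₀≤y
      ... | inj₂ y≤x₀ = ≢false⇒≡true λ x₀≰y →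
        noneBelow-elim (⇔-from (seg y) (y≤x₀ , ≢⇒eqB≡false λ { refl → not-¬ (≤-refl y) x₀≰y }))
                       s (≤-refl y)

  witnessing : Witnessing Y
  witnessing T T≠∅ = let (y , Ty , _) = least T T≠∅ in y , Ty

module _ {Y : SetD} {le : SetD.Carrier Y → SetD.Carrier Y → Bool} where
  open SetD Y
  open DomainProperties domain

  hasLeast⇒wellOrdered : (∀ x y → le x y ≡ true → le y x ≡ true → x ≡ y) →
                         (∀ x y → (le x y ≡ true) ⊎ (le y x ≡ true)) →
                         HasLeast Y le → WellOrdered Y le
  hasLeast⇒wellOrdered antisym total least P downClosed with isEmpty (not ∘ P) in e
  ... | true = inj₁ λ x → not-injective (⇔-to (isEmpty-spec _) e x)
  ... | false = inj₂ (segmentBelow (least (not ∘ P) (isEmpty≡false⇒NonEmpty {Y} e)))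
    where
    segmentBelow : Least Y le (not ∘ P) →
                   Σ[ a ∈ Carrier ] (∀ x → (P x ≡ true) ⇔ ((le x a ≡ true) × (eqB x a ≡ false)))
    segmentBelow (a₀ , ¬Pa₀ , minimal) = a₀ , λ x → mk⇔ (below x) (notAbove x)
      where
      Pa₀≡false : P a₀ ≡ false
      Pa₀≡false = not-injective ¬Pa₀

      below : ∀ x → P x ≡ true → (le x a₀ ≡ true) × (eqB x a₀ ≡ false)
      below x Px with total x a₀
      ... | inj₁ x≤a₀ = x≤a₀ , ≢⇒eqB≡false λ { refl → not-¬ Px Pa₀≡false }
      ... | inj₂ a₀≤x = ⊥-elim (not-¬ (downClosed a₀ x a₀≤x Px) Pa₀≡false)

      notAbove : ∀ x → (le x a₀ ≡ true) × (eqB x a₀ ≡ false) → P x ≡ true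
      notAbove x (x≤a₀ , x≢a₀) = ≢false⇒≡true λ Px≡false →
        eqB≡false⇒≢ x≢a₀ (antisym x a₀ x≤a₀ (minimal x (cong not Px≡false)))

module StrictOrder (W : WellOrder) where
  open WellOrder W
  open IsWellOrder isWO using (antisym) renaming (trans to ≤-trans)
  open DomainProperties domain

  _<ᵇ_ : Carrier → Carrier → Bool
  x <ᵇ y = le x y ∧ not (eqB x y)

  <ᵇ⇔< : ∀ {x y} → (x <ᵇ y ≡ true) ⇔ (x < y)
  <ᵇ⇔< = mk⇔ (λ e → let (x≤y , x≉y) = ∧-≡true e in x≤y , not-injective x≉y)
             (λ (x≤y , x≢y) → ≡true-∧ x≤y (cong not x≢y))

  <-≤-trans : ∀ {x y z} → x < y → y ≤ z → x < z
  <-≤-trans {x} {y} {z} (x≤y , x≢y) y≤z = ≤-trans x y z x≤y y≤z , ≢⇒eqB≡false λ { refl →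
    eqB≡false⇒≢ x≢y (antisym x y x≤y y≤z) }

record OrderEmbedding (X Y : WellOrder) : Set where
  field
    to        : WellOrder.Carrier X → WellOrder.Carrier Y
    mono      : ∀ {x x'} → WellOrder._≤_ X x x' → WellOrder._≤_ Y (to x) (to x')
    injective : Injective _≡_ _≡_ to

  strictMono : ∀ {x x'} → WellOrder._<_ X x x' → WellOrder._<_ Y (to x) (to x')
  strictMono (x≤x' , x≢x') =
    mono x≤x' , DomainProperties.≢⇒eqB≡false (WellOrder.domain Y)
                  (DomainProperties.eqB≡false⇒≢ (WellOrder.domain X) x≢x' ∘ injective)

open OrderEmbedding using (strictMono)

_∘ₑ_ : OrderEmbedding Y Z → OrderEmbedding X Y → OrderEmbedding X Z
e ∘ₑ d = record
  { to        = to e ∘ to d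
  ; mono      = mono e ∘ mono d
  ; injective = injective d ∘ injective e
  }
  where open OrderEmbedding

<𝕎⇒OrderEmbedding : X <𝕎 Y → OrderEmbedding X Y
<𝕎⇒OrderEmbedding (_ , f , ord , inj , _) =
  record { to = f ; mono = ⇔-to (ord _ _) ; injective = inj _ _ }

≅⇒OrderEmbedding : X ≅ Y → OrderEmbedding X Y
≅⇒OrderEmbedding (φ , ord) =
  record { to = Inverse.to φ ; mono = ⇔-to (ord _ _) ; injective = Injection.injective (↔⇒↣ φ) }

≅⇒OrderEmbedding⁻ : X ≅ Y → OrderEmbedding Y X
≅⇒OrderEmbedding⁻ {Y = Y} (φ , ord) = record
  { to        = Inverse.from φ
  ; mono      = λ {y} {y'} y≤y' → ⇔-from (ord _ _)
                  (subst₂ (WellOrder._≤_ Y) (sym (to∘from y)) (sym (to∘from y')) y≤y')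
  ; injective = Injection.injective (↔⇒↣ (↔-sym φ))
  }
  where
  to∘from : ∀ y → Inverse.to φ (Inverse.from φ y) ≡ y
  to∘from = Inverse.strictlyInverseˡ φ

-- A least x with e x < x would make e x a smaller one.
OrderEmbedding-¬< : (e : OrderEmbedding X X) → ∀ x → ¬ WellOrder._<_ X (OrderEmbedding.to e x) x
OrderEmbedding-¬< {X = X} e x ex<x =
  let open StrictOrder X
      open OrderEmbedding e using (to)
      (y , ey<ᵇy , minimal) = least (WellOrder.isWO X) (λ y → to y <ᵇ y) λ none →
        not-¬ (⇔-from <ᵇ⇔< ex<x) (none x)
      ey<y = ⇔-to <ᵇ⇔< ey<ᵇy
      y≤ey = minimal (to y) (⇔-from <ᵇ⇔< (strictMono e ey<y))
  in DomainProperties.eqB≡false⇒≢ (WellOrder.domain X) (proj₂ ey<y)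
       (IsWellOrder.antisym (WellOrder.isWO X) _ _ (proj₁ ey<y) y≤ey)

OrderEmbedding⇒¬<𝕎 : OrderEmbedding Y X → ¬ (X <𝕎 Y)
OrderEmbedding⇒¬<𝕎 g X<Y@(a₀ , k , _ , _ , below-a₀) =
  OrderEmbedding-¬< (g ∘ₑ <𝕎⇒OrderEmbedding X<Y) (to a₀)
    (strictMono g (⇔-from (below-a₀ (k (to a₀))) (to a₀ , refl)))
  where open OrderEmbedding g using (to)

module Pullback (X : WellOrder) (Y : SetD) (g↣ : SetD.Carrier Y ↣ WellOrder.Carrier X)
                (witness : Witnessing Y) where
  private
    open Injection g↣ using () renaming (to to g; injective to g-injective)
    module X = WellOrder X
    module XW = IsWellOrder X.isWO
    module XD = DomainProperties X.domain
    open SetD Y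

  le′ : Carrier → Carrier → Bool
  le′ a b = X.le (g a) (g b)

  image : (Carrier → Bool) → X.Carrier → Bool
  image S b = not (isEmpty λ a → X.eqB (g a) b ∧ S a)

  image-intro : ∀ {S a} → S a ≡ true → image S (g a) ≡ true
  image-intro {a = a} Sa = cong not (≢true⇒≡false λ e →
    not-¬ (≡true-∧ (XD.≡⇒eqB refl) Sa) (⇔-to (isEmpty-spec _) e a))

  image-elim : ∀ {S b} → image S b ≡ true → Σ[ a ∈ Carrier ] (g a ≡ b × S a ≡ true)
  image-elim im =
    let (a , e) = witness _ λ none → not-¬ im (cong not (⇔-from (isEmpty-spec _) none))
        (ga≡b , Sa) = ∧-≡true e
    in a , XD.eqB⇒≡ ga≡b , Sa

  hasLeast : HasLeast Y le′
  hasLeast S S≠∅ =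
    let (b₀ , imb₀ , minimal) = least X.isWO (image S) λ none →
          S≠∅ λ a → ≢true⇒≡false λ Sa → not-¬ (image-intro Sa) (none (g a))
        (a₀ , ga₀≡b₀ , Sa₀) = image-elim imb₀
    in a₀ , Sa₀ , λ a Sa → subst (λ b → X.le b (g a) ≡ true) (sym ga₀≡b₀)
                                 (minimal (g a) (image-intro Sa))

  antisym : ∀ a b → le′ a b ≡ true → le′ b a ≡ true → a ≡ b
  antisym a b p q = g-injective (XW.antisym _ _ p q)

  total : ∀ a b → (le′ a b ≡ true) ⊎ (le′ b a ≡ true)
  total a b = XW.total (g a) (g b)

  pullback : WellOrder
  pullback = record
    { set  = Y
    ; le   = le′
    ; isWO = record
      { refl    = λ a → XW.refl (g a)
      ; antisym = antisym
      ; trans   = λ a b c → XW.trans (g a) (g b) (g c)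
      ; total   = total
      ; wellOrd = hasLeast⇒wellOrdered {Y} antisym total hasLeast
      }
    }

  embedding : OrderEmbedding pullback X
  embedding = record { to = g ; mono = id ; injective = g-injective }

open Pullback using (pullback)

module Subset (Y : SetD) (S : SetD.Carrier Y → Bool) where
  open SetD Y

  Member : Set
  Member = Σ[ y ∈ Carrier ] S y ≡ true

  member-injective : ∀ {u v : Member} → proj₁ u ≡ proj₁ v → u ≡ v
  member-injective {y , p} {.y , q} refl = cong (y ,_) (Decidable⇒UIP.≡-irrelevant _≟_ p q)

  -- Lifting T to Y needs the membership proof, hence the detour through an
  -- arbitrary b with S y ≡ b.
  liftAt : (Member → Bool) → ∀ y b → S y ≡ b → Bool
  liftAt T y true  p = T (y , p)
  liftAt T y false _ = false

  lift : (Member → Bool) → Carrier → Bool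
  lift T y = liftAt T y (S y) refl

  liftAt-member : ∀ T y b (q : S y ≡ b) (p : S y ≡ true) → liftAt T y b q ≡ T (y , p)
  liftAt-member T y true  q p = cong (λ r → T (y , r)) (Decidable⇒UIP.≡-irrelevant _≟_ q p)
  liftAt-member T y false q p with () ← trans (sym q) p

  lift-member : ∀ T (u : Member) → lift T (proj₁ u) ≡ T u
  lift-member T (y , p) = liftAt-member T y (S y) refl p

  liftAt-elim : ∀ T y b (q : S y ≡ b) → liftAt T y b q ≡ true →
                Σ[ p ∈ S y ≡ true ] T (y , p) ≡ true
  liftAt-elim T y true q l = q , l

  lift-elim : ∀ T y → lift T y ≡ true → Σ[ p ∈ S y ≡ true ] T (y , p) ≡ true
  lift-elim T y = liftAt-elim T y (S y) refl

  subset : SetD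
  subset = record
    { domain = record
      { Carrier  = Member
      ; eqB      = λ u v → eqB (proj₁ u) (proj₁ v)
      ; eqB-spec = λ u v → mk⇔ (member-injective ∘ ⇔-to (eqB-spec _ _))
                               (⇔-from (eqB-spec _ _) ∘ cong proj₁)
      }
    ; isEmpty      = isEmpty ∘ lift
    ; isEmpty-spec = λ T → mk⇔
        (λ e u → trans (sym (lift-member T u)) (⇔-to (isEmpty-spec _) e (proj₁ u)))
        (λ none → ⇔-from (isEmpty-spec _) λ y → ≢true⇒≡false λ l →
          let (p , Tu) = lift-elim T y l in not-¬ Tu (none (y , p)))
    }

  subset-witnessing : Witnessing Y → Witnessing subset
  subset-witnessing witness T T≠∅ =
    let (y , l) = witness (lift T) λ none →
          T≠∅ λ u → trans (sym (lift-member T u)) (none (proj₁ u))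
        (p , Tu) = lift-elim T y l
    in (y , p) , Tu

restrict : (W : WellOrder) → (WellOrder.Carrier W → Bool) → WellOrder
restrict W S = pullback W subset (mk↣ member-injective)
                        (subset-witnessing (witnessing (WellOrder.isWO W)))
  where open Subset (WellOrder.set W) S

initialSegment : (W : WellOrder) → WellOrder.Carrier W → WellOrder
initialSegment W a = restrict W (_<ᵇ a)
  where open StrictOrder W

initialSegment-<𝕎 : (W : WellOrder) (a : WellOrder.Carrier W) → initialSegment W a <𝕎 W
initialSegment-<𝕎 W a = a , proj₁ , (λ _ _ → mk⇔ id id) , (λ _ _ → member-injective)
  , λ y → mk⇔ (λ y<a → (y , ⇔-from <ᵇ⇔< y<a) , refl)
              (λ { ((y , y<ᵇa) , refl) → ⇔-to <ᵇ⇔< y<ᵇa })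
  where
  open StrictOrder W
  open Subset (WellOrder.set W) (_<ᵇ a)

module _ (W : WellOrder) where
  open WellOrder W using (_≤_; _<_; domain; isWO)
  open StrictOrder W
  open DomainProperties domain

  initialSegment-embedding : ∀ {a' a} → a' ≤ a →
    OrderEmbedding (initialSegment W a') (initialSegment W a)
  initialSegment-embedding a'≤a = record
    { to        = λ (x , x<a') → x , ⇔-from <ᵇ⇔< (<-≤-trans (⇔-to <ᵇ⇔< x<a') a'≤a)
    ; mono      = id
    ; injective = Subset.member-injective (WellOrder.set W) _ ∘ cong proj₁
    }

  initialSegment-¬embedding : ∀ {a' a} → a' < a →
    ¬ OrderEmbedding (initialSegment W a) (initialSegment W a')
  initialSegment-¬embedding {a'} {a} a'<a e =
    OrderEmbedding-¬< (initialSegment-embedding (proj₁ a'<a) ∘ₑ e) a'∈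
      (⇔-to <ᵇ⇔< (proj₂ (OrderEmbedding.to e a'∈)))
    where
    a'∈ : WellOrder.Carrier (initialSegment W a)
    a'∈ = a' , ⇔-from <ᵇ⇔< a'<a

  initialSegment-injective : ∀ {a a'} → initialSegment W a ≅ initialSegment W a' → a ≡ a'
  initialSegment-injective {a} {a'} φ with WellOrder.eqB W a a' in e
  ... | true  = eqB⇒≡ e
  ... | false with IsWellOrder.total isWO a a'
  ...   | inj₁ a≤a' = ⊥-elim (initialSegment-¬embedding (a≤a' , e) (≅⇒OrderEmbedding⁻ φ))
  ...   | inj₂ a'≤a = ⊥-elim (initialSegment-¬embedding (a'≤a , ≢⇒eqB≡false (eqB≡false⇒≢ e ∘ sym))
                                                       (≅⇒OrderEmbedding φ))

  initialSegments : InjInto#< (WellOrder.set W) W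
  initialSegments = (λ a → initialSegment W a , initialSegment-<𝕎 W a) ,
                    λ _ _ → initialSegment-injective

<𝕎-sameBound⇒≅ : (p : X <𝕎 Z) (q : Y <𝕎 Z) → proj₁ p ≡ proj₁ q → X ≅ Y
<𝕎-sameBound⇒≅ {X = X} {Z = Z} {Y = Y}
  (z , f , f-ord , f-inj , f-onto) (.z , h , h-ord , h-inj , h-onto) refl =
  mk↔ₛ′ to from to∘from from∘to , to-ord
  where
  along-h : ∀ x → Σ[ y ∈ WellOrder.Carrier Y ] h y ≡ f x
  along-h x = ⇔-to (h-onto (f x)) (⇔-from (f-onto (f x)) (x , refl))

  along-f : ∀ y → Σ[ x ∈ WellOrder.Carrier X ] f x ≡ h y
  along-f y = ⇔-to (f-onto (h y)) (⇔-from (h-onto (h y)) (y , refl))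

  to : WellOrder.Carrier X → WellOrder.Carrier Y
  to = proj₁ ∘ along-h

  from : WellOrder.Carrier Y → WellOrder.Carrier X
  from = proj₁ ∘ along-f

  to∘from : ∀ y → to (from y) ≡ y
  to∘from y = h-inj _ _ (trans (proj₂ (along-h (from y))) (proj₂ (along-f y)))

  from∘to : ∀ x → from (to x) ≡ x
  from∘to x = f-inj _ _ (trans (proj₂ (along-f (to x))) (proj₂ (along-h x)))

  to-ord : ∀ x x' → WellOrder._≤_ X x x' ⇔ WellOrder._≤_ Y (to x) (to x')
  to-ord x x' = mk⇔
    (λ x≤x' → ⇔-from (h-ord (to x) (to x'))
      (subst₂ (WellOrder._≤_ Z) (sym (proj₂ (along-h x))) (sym (proj₂ (along-h x')))
        (⇔-to (f-ord x x') x≤x')))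
    (λ tx≤tx' → ⇔-from (f-ord x x')
      (subst₂ (WellOrder._≤_ Z) (proj₂ (along-h x)) (proj₂ (along-h x'))
        (⇔-to (h-ord (to x) (to x')) tx≤tx')))

-- a ↦ the bound in B of the initial segment f a.
InjInto#<⇒↣ : (A : SetD) (B : WellOrder) → InjInto#< A B →
  SetD.Carrier A ↣ WellOrder.Carrier B
InjInto#<⇒↣ A B (f , f-inj) = mk↣ {to = λ a → proj₁ (proj₂ (f a))} λ {a} {a'} same →
  f-inj a a' (<𝕎-sameBound⇒≅ {X = proj₁ (f a)} {Z = B} {Y = proj₁ (f a')}
                             (proj₂ (f a)) (proj₂ (f a')) same)

mainTheorem14 : (A : SetD) →
    -- Axiom of Choice: a chosen well-order on A (used to define card[A])
    Σ[ r ∈ (SetD.Carrier A → SetD.Carrier A → Bool) ] IsWellOrder A r →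
    (B : WellOrder) → IsCard A B →
    SetD.Carrier A ↔ WellOrder.Carrier B
mainTheorem14 A (r , r-isWO) B (A↪#<B , B-least) =
  [ (λ B<C → ⊥-elim (OrderEmbedding⇒¬<𝕎 (Pullback.embedding B A g witness) B<C))
  , (↔-sym ∘ proj₁)
  ]′ (B-least C (initialSegments C))
  where
  g : SetD.Carrier A ↣ WellOrder.Carrier B
  g = InjInto#<⇒↣ A B A↪#<B

  witness : Witnessing A
  witness = witnessing r-isWO

  C : WellOrder
  C = pullback B A g witness
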